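{- Assume $y\in\mathbb{Z}_p$ is $q$-full and let $i\in\{1,\dots,b\}$. Let $n$ be a positive integer and $m,k$ non-negative integers. Then (1) $d_i(n+p-1)\ge q\,d_i(n)$; (2) $y_i(m+p-1,k)\ge q\,y_i(m,k)$; (3) $y_i(m+p-1)>q\,y_i(m)$.
   Context: $p$ is a prime, $b\ge1$, $q=p^b$. Every $y\in\mathbb{Z}_p$ is written uniquely as $y=\sum_{i=1}^b p^{i-1}y_i$ with $y_i=\sum_{j\ge0}y_{i,j}q^j$ and $0\le y_{i,j}<p$ (so $y_{i,j}$ is the base-$p$ digit of $y$ in position $i-1+bj$). $y$ is $q$-full if no $y_i$ is a non-negative integer (i.e., each $y_i$ has infinitely many nonzero digits). For $y$ $q$-full and $n\ge1$, $d_i(n)=p^{i-1}q^{w}$ where $w\ge0$ is the unique integer with $\sum_{j=0}^{w-1}y_{i,j}<n\le\sum_{j=0}^{w}y_{i,j}$. For $m\in\mathbb{Z}$, $y_i(m)=\sum_{n=1}^m d_i(n)$ (which is $0$ if $m\le0$), and $y_i(m,k)=y_i(m+k)-y_i(m)$. -}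

module Defs where

open import Data.Nat using (ℕ; zero; suc; _+_; _*_; _∸_; _^_; _≤_; _<_)
open import Data.Fin using (Fin; toℕ)
open import Data.Product using (Σ; _×_)
open import Relation.Nullary using (¬_)
open import Relation.Binary.PropositionalEquality using (_≡_)

-- An element y of ℤ_p is represented by its base-p digit sequence:
-- y = Σ_t p^t * toℕ (y t).
Zp : ℕ → Set
Zp p = ℕ → Fin p

qOf : ℕ → ℕ → ℕ
qOf p b = p ^ b

-- y_{i,j} : base-p digit of y in position (i-1) + b*j   (i is 1-based)
digit : {p : ℕ} → (b : ℕ) → Zp p → ℕ → ℕ → ℕ
digit b y i j = toℕ (y ((i ∸ 1) + b * j))

S : {p : ℕ} → (b : ℕ) → Zp p → ℕ → ℕ → ℕ
S b y i zero    = 0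
S b y i (suc w) = S b y i w + digit b y i w

-- y_i is a non-negative integer: all but finitely many of its digits vanish
IsNatComponent : {p : ℕ} → (b : ℕ) → Zp p → ℕ → Set
IsNatComponent b y i = Σ ℕ (λ N → (j : ℕ) → N ≤ j → digit b y i j ≡ 0)

QFull : {p : ℕ} → (b : ℕ) → Zp p → Set
QFull b y = (i : ℕ) → 1 ≤ i → i ≤ b → ¬ IsNatComponent b y i

IsIndex : {p : ℕ} → (b : ℕ) → Zp p → ℕ → ℕ → ℕ → Set
IsIndex b y i n w = (S b y i w < n) × (n ≤ S b y i (suc w))

dOf : (p b i : ℕ) → (ℕ → ℕ) → ℕ → ℕ
dOf p b i w n = p ^ (i ∸ 1) * qOf p b ^ w n

Yof : (p b i : ℕ) → (ℕ → ℕ) → ℕ → ℕ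
Yof p b i w zero    = 0
Yof p b i w (suc m) = Yof p b i w m + dOf p b i w (suc m)

Y2of : (p b i : ℕ) → (ℕ → ℕ) → ℕ → ℕ → ℕ
Y2of p b i w m k = Yof p b i w (m + k) ∸ Yof p b i w m

-- Since every digit y_{i,j} is at most p - 1, the partial sums Σ_{j ≤ w} y_{i,j} grow by at
-- most p - 1 per step, so moving from n to n + p - 1 forces the index w to increase: this is
-- (1), as d_i(n) = p^{i-1} q^{w(n)}. Summing (1) termwise over the window (m, m + k] gives (2),
-- and (3) follows from y_i(m + p - 1) = y_i(p - 1) + y_i(p - 1, m) with y_i(p - 1) > 0.
module Submission where

open import Defs
open import Data.Nat using (ℕ; zero; suc; _+_; _*_; _∸_; _^_; _≤_; _<_; _≥_; _>_; _≰_; z≤n; s≤s; s≤s⁻¹; NonZero)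
open import Data.Nat.Properties
open import Data.Nat.Primality using (Prime; prime⇒nonZero; prime⇒nonTrivial)
open import Data.Nat.Base using (nonTrivial⇒n>1; >-nonZero⁻¹)
open import Data.Sum using (inj₁; inj₂)
open import Data.Product using (_×_; _,_; proj₁; proj₂)
open import Data.Fin.Properties using (toℕ<n)
open import Relation.Binary.PropositionalEquality using (_≡_; refl; sym; trans; cong; cong₂; module ≡-Reasoning)
import Algebra.Properties.CommutativeSemigroup as CommSemigroupProperties
open CommSemigroupProperties +-commutativeSemigroup using (xy∙z≈xz∙y)
open CommSemigroupProperties *-commutativeSemigroup using (x∙yz≈y∙xz)

module _ {p : ℕ} (b : ℕ) (y : Zp p) (i : ℕ) where

  digit≤pred : ∀ j → digit b y i j ≤ p ∸ 1
  digit≤pred j = pred-mono-≤ (toℕ<n (y ((i ∸ 1) + b * j)))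

  S-mono-≤ : ∀ {u v} → u ≤ v → S b y i u ≤ S b y i v
  S-mono-≤ {v = zero} z≤n = ≤-refl
  S-mono-≤ {u} {suc v} u≤1+v with m≤n⇒m<n∨m≡n u≤1+v
  ... | inj₁ u<1+v = ≤-trans (S-mono-≤ (s≤s⁻¹ u<1+v)) (m≤m+n _ _)
  ... | inj₂ refl  = ≤-refl

  index-<-shift : (w : ℕ → ℕ) → (∀ n → 1 ≤ n → IsIndex b y i n (w n)) →
                  ∀ n → 1 ≤ n → w n < w (n + (p ∸ 1))
  index-<-shift w isIndex n 1≤n = ≰⇒> w[n+c]≰w[n]
    where
    c = p ∸ 1
    w[n+c]≰w[n] : w (n + c) ≰ w n
    w[n+c]≰w[n] w[n+c]≤w[n] = <-irrefl refl (begin-strict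
      n + c                       ≤⟨ proj₂ (isIndex (n + c) (≤-trans 1≤n (m≤m+n n c))) ⟩
      S b y i (suc (w (n + c)))   ≤⟨ S-mono-≤ (s≤s w[n+c]≤w[n]) ⟩
      S b y i (w n) + digit b y i (w n)
                                  <⟨ +-mono-<-≤ (proj₁ (isIndex n 1≤n)) (digit≤pred (w n)) ⟩
      n + c                       ∎)
      where open ≤-Reasoning

module _ {p : ℕ} .{{_ : NonZero p}} (b i : ℕ) (w : ℕ → ℕ) where

  dOf-pos : ∀ n → 0 < dOf p b i w n
  dOf-pos n = >-nonZero⁻¹ _ {{m*n≢0 (p ^ (i ∸ 1)) (qOf p b ^ w n)
                               {{m^n≢0 p (i ∸ 1)}} {{m^n≢0 (qOf p b) (w n) {{m^n≢0 p b}}}}}}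

  dOf-index-< : ∀ {u v} → w u < w v → qOf p b * dOf p b i w u ≤ dOf p b i w v
  dOf-index-< {u} {v} wu<wv = begin
    q * (p ^ (i ∸ 1) * q ^ w u)  ≡⟨ x∙yz≈y∙xz q (p ^ (i ∸ 1)) (q ^ w u) ⟩
    p ^ (i ∸ 1) * q ^ suc (w u)  ≤⟨ *-monoʳ-≤ (p ^ (i ∸ 1)) (^-monoʳ-≤ q {{m^n≢0 p b}} wu<wv) ⟩
    p ^ (i ∸ 1) * q ^ w v        ∎
    where
    open ≤-Reasoning
    q = qOf p b

window : (ℕ → ℕ) → ℕ → ℕ → ℕ
window f a zero    = 0
window f a (suc k) = window f a k + f (a + suc k)

module _ (f : ℕ → ℕ) where

  window-+ : ∀ a m k → window f a (m + k) ≡ window f a m + window f (a + m) k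
  window-+ a m zero rewrite +-identityʳ m = sym (+-identityʳ _)
  window-+ a m (suc k) = begin
    window f a (m + suc k)
      ≡⟨ cong (window f a) (+-suc m k) ⟩
    window f a (m + k) + f (a + suc (m + k))
      ≡⟨ cong₂ _+_ (window-+ a m k) (cong f (trans (cong (a +_) (sym (+-suc m k))) (sym (+-assoc a m (suc k))))) ⟩
    window f a m + window f (a + m) k + f (a + m + suc k)
      ≡⟨ +-assoc (window f a m) (window f (a + m) k) _ ⟩
    window f a m + window f (a + m) (suc k) ∎
    where open ≡-Reasoning

  window-pos : (∀ n → 0 < f n) → ∀ a k → 0 < k → 0 < window f a k
  window-pos f>0 a (suc k) _ = ≤-trans (f>0 (a + suc k)) (m≤n+m _ _)

  module _ {q c : ℕ} (shift : ∀ n → 1 ≤ n → q * f n ≤ f (n + c)) where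

    window-shift : ∀ m k → q * window f m k ≤ window f (m + c) k
    window-shift m zero = ≤-reflexive (*-zeroʳ q)
    window-shift m (suc k) = begin
      q * (window f m k + f (m + suc k))
        ≡⟨ *-distribˡ-+ q (window f m k) _ ⟩
      q * window f m k + q * f (m + suc k)
        ≤⟨ +-mono-≤ (window-shift m k) (shift (m + suc k) (≤-trans (s≤s z≤n) (m≤n+m (suc k) m))) ⟩
      window f (m + c) k + f (m + suc k + c)
        ≡⟨ cong (λ n → window f (m + c) k + f n) (xy∙z≈xz∙y m (suc k) c) ⟩
      window f (m + c) k + f (m + c + suc k) ∎
      where open ≤-Reasoning

    window-shift-< : (∀ n → 0 < f n) → 0 < c → ∀ m → q * window f 0 m < window f 0 (m + c)
    window-shift-< f>0 c>0 m = begin-strict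
      q * window f 0 m         ≤⟨ window-shift 0 m ⟩
      window f c m             <⟨ m<n+m _ (window-pos f>0 0 c c>0) ⟩
      window f 0 c + window f c m  ≡⟨ sym (window-+ 0 c m) ⟩
      window f 0 (c + m)       ≡⟨ cong (window f 0) (+-comm c m) ⟩
      window f 0 (m + c)       ∎
      where open ≤-Reasoning

Yof≡window : ∀ p b i w m → Yof p b i w m ≡ window (dOf p b i w) 0 m
Yof≡window p b i w zero = refl
Yof≡window p b i w (suc m) = cong (_+ dOf p b i w (suc m)) (Yof≡window p b i w m)

Y2of≡window : ∀ p b i w m k → Y2of p b i w m k ≡ window (dOf p b i w) m k
Y2of≡window p b i w m k = begin
  Yof p b i w (m + k) ∸ Yof p b i w m
    ≡⟨ cong₂ _∸_ (Yof≡window p b i w (m + k)) (Yof≡window p b i w m) ⟩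
  window d 0 (m + k) ∸ window d 0 m
    ≡⟨ cong (_∸ window d 0 m) (window-+ d 0 m k) ⟩
  window d 0 m + window d m k ∸ window d 0 m
    ≡⟨ m+n∸m≡n (window d 0 m) (window d m k) ⟩
  window d m k ∎
  where
  open ≡-Reasoning
  d = dOf p b i w

lemma6p5 : (p b : ℕ) → Prime p → 1 ≤ b → (y : Zp p) → QFull b y →
    (i : ℕ) → 1 ≤ i → i ≤ b →
    (w : ℕ → ℕ) → ((n : ℕ) → 1 ≤ n → IsIndex b y i n (w n)) →
    ((n : ℕ) → 1 ≤ n → dOf p b i w (n + p ∸ 1) ≥ qOf p b * dOf p b i w n)
    × ((m k : ℕ) → Y2of p b i w (m + p ∸ 1) k ≥ qOf p b * Y2of p b i w m k)
    × ((m : ℕ) → Yof p b i w (m + p ∸ 1) > qOf p b * Yof p b i w m)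
-- q-fullness only serves to make the index function w exist; here w is given.
lemma6p5 p b p-prime _ y _ i _ _ w isIndex = part1 , part2 , part3
  where
  instance
    p≢0 : NonZero p
    p≢0 = prime⇒nonZero p-prime
  c = p ∸ 1
  d = dOf p b i w
  q = qOf p b

  n+p∸1≡n+c : ∀ n → n + p ∸ 1 ≡ n + c
  n+p∸1≡n+c n = +-∸-assoc n (>-nonZero⁻¹ p)

  c>0 : 0 < c
  c>0 = m<n⇒0<n∸m (nonTrivial⇒n>1 p {{prime⇒nonTrivial p-prime}})

  shift : ∀ n → 1 ≤ n → q * d n ≤ d (n + c)
  shift n 1≤n = dOf-index-< b i w (index-<-shift b y i w isIndex n 1≤n)

  part1 : ∀ n → 1 ≤ n → d (n + p ∸ 1) ≥ q * d n
  part1 n 1≤n rewrite n+p∸1≡n+c n = shift n 1≤n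

  part2 : ∀ m k → Y2of p b i w (m + p ∸ 1) k ≥ q * Y2of p b i w m k
  part2 m k rewrite n+p∸1≡n+c m | Y2of≡window p b i w (m + c) k | Y2of≡window p b i w m k =
    window-shift d {q} shift m k

  part3 : ∀ m → Yof p b i w (m + p ∸ 1) > q * Yof p b i w m
  part3 m rewrite n+p∸1≡n+c m | Yof≡window p b i w (m + c) | Yof≡window p b i w m =
    window-shift-< d {q} shift (dOf-pos b i w) c>0 m
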